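{- Let $m_1,m_2,n_2$ be positive integers, $n_1\ge2$, and let $P$ be a regular partition of $K_{m_1(n_1),m_2(n_2)}$ such that $\tau(P)$ is asymmetric. Then $$v(\tau'(P)) \leq \sum_{G \in \mathrm{Comp}(P)}v(G) + m_2 2^{m_2-1}.$$
   Context: $X=K_{m_1(n_1),m_2(n_2)}$ is the complete multipartite graph with parts $A_1,\dots,A_{m_1}$ of size $n_1$ and $B_1,\dots,B_{m_2}$ of size $n_2$. A partition $P$ of $V(X)$ is regular if each part of $P$ meets each $A_i$ and each $B_i$ in at most one vertex. The hypergraph $\tau(P)$ has the parts of $P$ as vertices, the sets $A_i,B_i$ as edges, and a part $Q$ incident to an edge $Y$ iff $|Y\cap Q|=1$; it is asymmetric if its only automorphism (pair of incidence-preserving permutations of vertices and edges) is trivial. The vertex-labelled hypergraph $\tau'(P)$ has the vertices of $\tau(P)$ and only the edges $A_1,\dots,A_{m_1}$; a vertex $Q$ is labelled $L(Q)=\{i: Q\text{ incident to }B_i\}\subseteq\{1,\dots,m_2\}$, with weight $w(Q)=|L(Q)|$. For a subhypergraph $G$ of $\tau'(P)$, $w(G)$ is the sum of the weights of its vertices and its value is $v(G)=w(G)-r m_2|E(G)|$, where $r=r_{n_1,m_2}$ is defined as follows: $r_{2,m_2}=1$; for $n_1\ge3$, with integers $j\ge0,k\ge0$ such that $n_1=2+\sum_{i=0}^{j}\binom{m_2}{i}+k$ and either ($j<\lfloor(m_2-1)/2\rfloor$, $0\le k<\binom{m_2}{j+1}$) or ($j=\lfloor(m_2-1)/2\rfloor$,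 $k\ge0$), $r=1+\sum_{i=0}^{j}\frac{m_2-i}{m_2}\binom{m_2}{i}+\frac{m_2-j-1}{m_2}k$ in the first case and $r=1+\sum_{i=0}^{j}\frac{m_2-i}{m_2}\binom{m_2}{i}+\frac{k}{2}$ in the second. In particular $v(\tau'(P))=w(\tau'(P))-rm_2m_1$ with $w(\tau'(P))$ summing over all vertices. $\mathrm{Comp}(P)$ is the set of connected components of $\tau'(P)$ containing at least one edge (components are connected in the sense that the vertex–edge incidence graph is connected). -}

module Defs where

open import Data.Bool using (Bool; true; false; _∧_; _∨_; not; if_then_else_)
open import Data.Nat as ℕ using (ℕ; zero; suc; _∸_; _<ᵇ_; _≤ᵇ_; _≡ᵇ_; NonZero)
open import Data.Nat.Combinatorics using (_C_)
open import Data.Fin using (Fin; toℕ)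
open import Data.Fin.Properties using (_≟_)
open import Data.Sum using (_⊎_; inj₁; inj₂)
open import Data.Product using (_×_; _,_; proj₁; proj₂)
open import Data.Integer using (+_)
open import Data.Rational as ℚ using (ℚ; 0ℚ; 1ℚ)
open import Relation.Nullary.Decidable using (⌊_⌋)
open import Relation.Binary.PropositionalEquality using (_≡_)
open import Function.Bundles using (_↔_; Inverse)

sumℕ : ∀ {n} → (Fin n → ℕ) → ℕ
sumℕ {zero}  f = 0
sumℕ {suc n} f = f Fin.zero ℕ.+ sumℕ (λ i → f (Fin.suc i))
  where import Data.Fin as Fin

sumℚ : ∀ {n} → (Fin n → ℚ) → ℚ
sumℚ {zero}  f = 0ℚ
sumℚ {suc n} f = f Fin.zero ℚ.+ sumℚ (λ i → f (Fin.suc i))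
  where import Data.Fin as Fin

count : ∀ {n} → (Fin n → Bool) → ℕ
count b = sumℕ (λ i → if b i then 1 else 0)

anyF : ∀ {n} → (Fin n → Bool) → Bool
anyF {zero}  b = false
anyF {suc n} b = b Fin.zero ∨ anyF (λ i → b (Fin.suc i))
  where import Data.Fin as Fin

ℕ→ℚ : ℕ → ℚ
ℕ→ℚ n = + n ℚ./ 1

hBound : ℕ → ℕ
hBound m2 = (m2 ∸ 1) ℕ./ 2

-- The result is the unique (j,k) with n1 = 2 + Σ_{i≤j} C(m2,i) + k and the
-- side conditions of the paper.  Fuel: each step decreases k by ≥ 1.
decompGo : (m2 j k fuel : ℕ) → ℕ × ℕ
decompGo m2 j k zero = j , k
decompGo m2 j k (suc fuel) =
  if (j <ᵇ hBound m2) ∧ (m2 C suc j ≤ᵇ k)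
  then decompGo m2 (suc j) (k ∸ (m2 C suc j)) fuel
  else (j , k)

decomp : (n1 m2 : ℕ) → ℕ × ℕ
decomp n1 m2 = decompGo m2 0 (n1 ∸ 3) (suc n1)

rSum : (m2 : ℕ) → .{{NonZero m2}} → ℕ → ℚ
rSum m2 zero    = (+ ((m2 ∸ 0) ℕ.* (m2 C 0))) ℚ./ m2
rSum m2 (suc j) = rSum m2 j ℚ.+ ((+ ((m2 ∸ suc j) ℕ.* (m2 C suc j))) ℚ./ m2)

r : (n1 m2 : ℕ) → .{{NonZero m2}} → ℚ
r zero m2 = 1ℚ                        -- not used (n1 ≥ 2 in the paper)
r (suc zero) m2 = 1ℚ                  -- not used
r (suc (suc zero)) m2 = 1ℚ
r n1@(suc (suc (suc _))) m2 =
  let j = proj₁ (decomp n1 m2) ; k = proj₂ (decomp n1 m2) in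
  if j <ᵇ hBound m2
  then 1ℚ ℚ.+ rSum m2 j ℚ.+ ((+ ((m2 ∸ suc j) ℕ.* k)) ℚ./ m2)
  else 1ℚ ℚ.+ rSum m2 j ℚ.+ ((+ k) ℚ./ 2)

-- Regular partitions of K_{m1(n1),m2(n2)}
-- Vertices of X: (i , x) ∈ Fin m1 × Fin n1 (the part A_i) and
-- (j , y) ∈ Fin m2 × Fin n2 (the part B_j).  A partition of V(X) into p
-- (nonempty) blocks is given by a block-assignment which is surjective onto Fin p.

record Partition (m1 n1 m2 n2 : ℕ) : Set where
  field
    p     : ℕ
    partA : Fin m1 → Fin n1 → Fin p
    partB : Fin m2 → Fin n2 → Fin p
    surj  : (Q : Fin p) →
              (Data.Product.∃ λ i → Data.Product.∃ λ x → partA i x ≡ Q) ⊎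
              (Data.Product.∃ λ j → Data.Product.∃ λ y → partB j y ≡ Q)
open Partition public

Regular : ∀ {m1 n1 m2 n2} → Partition m1 n1 m2 n2 → Set
Regular P =
  (∀ i x x' → partA P i x ≡ partA P i x' → x ≡ x') ×
  (∀ j y y' → partB P j y ≡ partB P j y' → y ≡ y')

-- Incidence in τ(P): block Q is incident to edge Y iff |Y ∩ Q| = 1
incA : ∀ {m1 n1 m2 n2} (P : Partition m1 n1 m2 n2) → Fin (p P) → Fin m1 → Bool
incA P Q i = count (λ x → ⌊ partA P i x ≟ Q ⌋) ≡ᵇ 1

incB : ∀ {m1 n1 m2 n2} (P : Partition m1 n1 m2 n2) → Fin (p P) → Fin m2 → Bool
incB P Q j = count (λ y → ⌊ partB P j y ≟ Q ⌋) ≡ᵇ 1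

-- Edges of τ(P): A_1..A_{m1}, B_1..B_{m2}
Edge : ℕ → ℕ → Set
Edge m1 m2 = Fin m1 ⊎ Fin m2

inc : ∀ {m1 n1 m2 n2} (P : Partition m1 n1 m2 n2) → Fin (p P) → Edge m1 m2 → Bool
inc P Q (inj₁ i) = incA P Q i
inc P Q (inj₂ j) = incB P Q j

IsAut : ∀ {m1 n1 m2 n2} (P : Partition m1 n1 m2 n2) →
        (Fin (p P) ↔ Fin (p P)) → (Edge m1 m2 ↔ Edge m1 m2) → Set
IsAut P σ π = ∀ Q Y → inc P Q Y ≡ inc P (Inverse.to σ Q) (Inverse.to π Y)

Asymmetric : ∀ {m1 n1 m2 n2} → Partition m1 n1 m2 n2 → Set
Asymmetric {m1} {n1} {m2} {n2} P =
  (σ : Fin (p P) ↔ Fin (p P)) (π : Edge m1 m2 ↔ Edge m1 m2) → IsAut P σ π →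
  (∀ Q → Inverse.to σ Q ≡ Q) × (∀ Y → Inverse.to π Y ≡ Y)

-- τ'(P): vertices = blocks, edges = A_1..A_{m1}, labels from B-incidences

weight : ∀ {m1 n1 m2 n2} (P : Partition m1 n1 m2 n2) → Fin (p P) → ℕ
weight P Q = count (λ j → incB P Q j)

adj : ∀ {m1 n1 m2 n2} (P : Partition m1 n1 m2 n2) → Fin m1 → Fin m1 → Bool
adj P i i' = anyF (λ Q → incA P Q i ∧ incA P Q i')

reachIn : ∀ {m1 n1 m2 n2} (P : Partition m1 n1 m2 n2) → ℕ → Fin m1 → Fin m1 → Bool
reachIn P zero i i' = ⌊ i ≟ i' ⌋
reachIn P (suc s) i i' = reachIn P s i i' ∨ anyF (λ i'' → reachIn P s i i'' ∧ adj P i'' i')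

reach : ∀ {m1 n1 m2 n2} (P : Partition m1 n1 m2 n2) → Fin m1 → Fin m1 → Bool
reach {m1} P = reachIn P m1

compEdge : ∀ {m1 n1 m2 n2} (P : Partition m1 n1 m2 n2) → Fin m1 → Fin m1 → Bool
compEdge P i i' = reach P i i'

compVertex : ∀ {m1 n1 m2 n2} (P : Partition m1 n1 m2 n2) → Fin m1 → Fin (p P) → Bool
compVertex P i Q = anyF (λ i' → reach P i i' ∧ incA P Q i')

valueComp : ∀ {m1 n1 m2 n2} → .{{NonZero m2}} → Partition m1 n1 m2 n2 → Fin m1 → ℚ
valueComp {m1} {n1} {m2} P i =
  ℕ→ℚ (sumℕ (λ Q → if compVertex P i Q then weight P Q else 0))
  ℚ.- r n1 m2 ℚ.* ℕ→ℚ m2 ℚ.* ℕ→ℚ (count (compEdge P i))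

valueTotal : ∀ {m1 n1 m2 n2} → .{{NonZero m2}} → Partition m1 n1 m2 n2 → ℚ
valueTotal {m1} {n1} {m2} P =
  ℕ→ℚ (sumℕ (weight P)) ℚ.- r n1 m2 ℚ.* ℕ→ℚ m2 ℚ.* ℕ→ℚ m1

-- Each component with at least one edge is counted once, via its
-- representative edge of least index.
isRep : ∀ {m1 n1 m2 n2} (P : Partition m1 n1 m2 n2) → Fin m1 → Bool
isRep P i = not (anyF (λ i' → (toℕ i' <ᵇ toℕ i) ∧ reach P i i'))

sumComp : ∀ {m1 n1 m2 n2} → .{{NonZero m2}} → Partition m1 n1 m2 n2 → ℚ
sumComp P = sumℚ (λ i → if isRep P i then valueComp P i else 0ℚ)

module Submission where

-- Write W for the total weight of τ'(P) and X = r·m2.  Then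
--   v(τ'(P)) = W - X·m1   and   Σ_G v(G) = Σ_G w(G) - X·Σ_G |E(G)|.  Reachability between the edges A_i is an equivalence
--     relation (the bounded iteration defining it saturates after m1
--     steps); each class has a unique least representative, so the
--     components partition the edges: Σ_G |E(G)| = m1.
--   * Vertices.  Every vertex on some edge A_i lies in a component, so
--     W ≤ Σ_G w(G) + (weight of the vertices on no edge A_i).
--   * Asymmetry.  Two vertices on no A_i with the same label L(Q) meet
--     exactly the same edges of τ(P), so swapping them would be an
--     automorphism; hence such vertices have distinct labels and their
--     weight is at most Σ_{S ⊆ {1..m2}} |S| = m2·2^(m2-1).

module Combinatorics where

  open import Defs
  open import Data.Bool using (Bool; true; false; _∧_; _∨_; not; if_then_else_)
  open import Data.Bool.Properties using (∨-zeroʳ; ∧-comm; T-≡) renaming (_≟_ to _≟ᵇ_)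
  open import Data.Nat using (ℕ; zero; suc; _+_; _*_; _∸_; _^_; _≤_; _<_; z≤n; s≤s; _<ᵇ_)
  open import Data.Nat.Properties
    using (+-identityʳ; +-suc; ≤-refl; ≤-reflexive; ≤-trans; ≤-pred; <⇒≱; n<1+n; m≤m+n; m≤n+m;
           m≤n⇒m≤1+n; m≤n⇒∃[o]m+o≡n; +-mono-≤; +-mono-<-≤; +-mono-≤-<; <ᵇ⇒<; <⇒<ᵇ;
           +-commutativeSemigroup; +-0-commutativeMonoid; module ≤-Reasoning)
  open import Data.Nat.Solver using (module +-*-Solver)
  open import Data.Fin using (Fin; toℕ; zero; suc)
  open import Data.Fin.Properties using (suc-injective; 0≢1+n; _≟_; <-cmp)
  import Data.Fin.Permutation as Perm
  import Data.Fin.Permutation.Components as PC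
  open import Data.Product using (∃; _×_; _,_; proj₁; proj₂)
  open import Data.Sum using (_⊎_; inj₁; inj₂)
  open import Data.Empty using (⊥-elim)
  open import Function.Bundles using (Equivalence)
  open import Function.Construct.Identity using (↔-id)
  open import Relation.Binary using (tri<; tri≈; tri>)
  open import Relation.Nullary using (¬_; yes; no)
  open import Relation.Nullary.Decidable using (⌊_⌋; dec-true; isYes≗does)
  open import Relation.Binary.PropositionalEquality
  open import Algebra.Properties.CommutativeSemigroup +-commutativeSemigroup using (interchange)
  open import Algebra.Properties.CommutativeMonoid.Sum +-0-commutativeMonoid using (sum; ∑-distrib-+; ∑-comm)

  sumℕ≡sum : ∀ {n} (f : Fin n → ℕ) → sumℕ f ≡ sum f
  sumℕ≡sum {zero}  f = refl
  sumℕ≡sum {suc n} f = cong (f zero +_) (sumℕ≡sum (λ i → f (suc i)))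

  sumℕ-cong : ∀ {n} {f g : Fin n → ℕ} → (∀ i → f i ≡ g i) → sumℕ f ≡ sumℕ g
  sumℕ-cong {zero}  f≗g = refl
  sumℕ-cong {suc n} f≗g = cong₂ _+_ (f≗g zero) (sumℕ-cong (λ i → f≗g (suc i)))

  sumℕ-+ : ∀ {n} (f g : Fin n → ℕ) → sumℕ (λ i → f i + g i) ≡ sumℕ f + sumℕ g
  sumℕ-+ f g = begin
    sumℕ (λ i → f i + g i) ≡⟨ sumℕ≡sum (λ i → f i + g i) ⟩
    sum (λ i → f i + g i)  ≡⟨ ∑-distrib-+ f g ⟩
    sum f + sum g          ≡⟨ sym (cong₂ _+_ (sumℕ≡sum f) (sumℕ≡sum g)) ⟩
    sumℕ f + sumℕ g        ∎
    where open ≡-Reasoning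

  sumℕ-comm : ∀ {m n} (f : Fin m → Fin n → ℕ) →
    sumℕ (λ i → sumℕ (f i)) ≡ sumℕ (λ j → sumℕ (λ i → f i j))
  sumℕ-comm f = begin
    sumℕ (λ i → sumℕ (f i))          ≡⟨ sumℕ-cong (λ i → sumℕ≡sum (f i)) ⟩
    sumℕ (λ i → sum (f i))           ≡⟨ sumℕ≡sum (λ i → sum (f i)) ⟩
    sum (λ i → sum (f i))            ≡⟨ ∑-comm f ⟩
    sum (λ j → sum (λ i → f i j))    ≡⟨ sym (sumℕ≡sum (λ j → sum (λ i → f i j))) ⟩
    sumℕ (λ j → sum (λ i → f i j))   ≡⟨ sym (sumℕ-cong (λ j → sumℕ≡sum (λ i → f i j))) ⟩
    sumℕ (λ j → sumℕ (λ i → f i j))  ∎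
    where open ≡-Reasoning

  sumℕ-zero : ∀ {n} (f : Fin n → ℕ) → (∀ i → f i ≡ 0) → sumℕ f ≡ 0
  sumℕ-zero {zero}  f f≗0 = refl
  sumℕ-zero {suc n} f f≗0 rewrite f≗0 zero = sumℕ-zero (λ i → f (suc i)) (λ i → f≗0 (suc i))

  sumℕ-mono : ∀ {n} {f g : Fin n → ℕ} → (∀ i → f i ≤ g i) → sumℕ f ≤ sumℕ g
  sumℕ-mono {zero}  f≤g = z≤n
  sumℕ-mono {suc n} f≤g = +-mono-≤ (f≤g zero) (sumℕ-mono (λ i → f≤g (suc i)))

  sumℕ-strict : ∀ {n} {f g : Fin n → ℕ} → (∀ i → f i ≤ g i) → ∀ k → f k < g k → sumℕ f < sumℕ g
  sumℕ-strict f≤g zero    fk<gk = +-mono-<-≤ fk<gk (sumℕ-mono (λ i → f≤g (suc i)))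
  sumℕ-strict f≤g (suc k) fk<gk = +-mono-≤-< (f≤g zero) (sumℕ-strict (λ i → f≤g (suc i)) k fk<gk)

  term≤sumℕ : ∀ {n} (f : Fin n → ℕ) i → f i ≤ sumℕ f
  term≤sumℕ f zero    = m≤m+n _ _
  term≤sumℕ f (suc i) = ≤-trans (term≤sumℕ (λ i → f (suc i)) i) (m≤n+m _ _)

  sumℕ-single : ∀ {n} (f : Fin n → ℕ) i₀ → (∀ i → ¬ i ≡ i₀ → f i ≡ 0) → sumℕ f ≡ f i₀
  sumℕ-single f zero f≗0 = trans (cong (f zero +_) (sumℕ-zero _ (λ i → f≗0 (suc i) λ ()))) (+-identityʳ _)
  sumℕ-single f (suc i₀) f≗0 rewrite f≗0 zero (λ ()) =
    sumℕ-single (λ i → f (suc i)) i₀ (λ i i≢i₀ → f≗0 (suc i) (λ eq → i≢i₀ (suc-injective eq)))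

  sumℕ-atMostOne : ∀ {n} (sel : Fin n → Bool) c → (∀ i j → sel i ≡ true → sel j ≡ true → i ≡ j) →
    sumℕ (λ i → if sel i then c else 0) ≤ c
  sumℕ-atMostOne {zero} sel c unique = z≤n
  sumℕ-atMostOne {suc n} sel c unique with sel zero in sel₀
  ... | false = sumℕ-atMostOne (λ i → sel (suc i)) c (λ i j si sj → suc-injective (unique (suc i) (suc j) si sj))
  ... | true  = ≤-reflexive (trans (cong (c +_) (sumℕ-zero _ nothing-else)) (+-identityʳ c))
    where
      nothing-else : ∀ i → (if sel (suc i) then c else 0) ≡ 0
      nothing-else i with sel (suc i) in selᵢ
      ... | false = refl
      ... | true  = ⊥-elim (0≢1+n (unique zero (suc i) sel₀ selᵢ))

  sumℕ-ones : ∀ n → sumℕ {n} (λ _ → 1) ≡ n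
  sumℕ-ones zero    = refl
  sumℕ-ones (suc n) = cong suc (sumℕ-ones n)

  if-sumℕ : ∀ {n} b (f : Fin n → ℕ) → (if b then sumℕ f else 0) ≡ sumℕ (λ i → if b then f i else 0)
  if-sumℕ true  f = refl
  if-sumℕ {n} false f = sym (sumℕ-zero {n} (λ _ → 0) (λ _ → refl))

  count≤n : ∀ {n} (S : Fin n → Bool) → count S ≤ n
  count≤n {n} S = ≤-trans (sumℕ-mono indicator≤1) (≤-reflexive (sumℕ-ones n))
    where
      indicator≤1 : ∀ i → (if S i then 1 else 0) ≤ 1
      indicator≤1 i with S i
      ... | true  = ≤-refl
      ... | false = z≤n

  count-strict : ∀ {n} (S T : Fin n → Bool) → (∀ i → S i ≡ true → T i ≡ true) →
    ∀ k → S k ≡ false → T k ≡ true → count S < count T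
  count-strict S T S⊆T k k∉S k∈T = sumℕ-strict indicator-mono k (indicator-strict k∉S k∈T)
    where
      indicator-mono : ∀ i → (if S i then 1 else 0) ≤ (if T i then 1 else 0)
      indicator-mono i with S i in i∈S
      ... | false = z≤n
      ... | true rewrite S⊆T i i∈S = ≤-refl
      indicator-strict : ∀ {a b} → a ≡ false → b ≡ true → (if a then 1 else 0) < (if b then 1 else 0)
      indicator-strict refl refl = s≤s z≤n

  anyF-witness : ∀ {n} (b : Fin n → Bool) → anyF b ≡ true → ∃ λ i → b i ≡ true
  anyF-witness {suc n} b any≡true with b zero in b₀
  ... | true  = zero , b₀
  ... | false with anyF-witness (λ i → b (suc i)) any≡true
  ...   | i , bᵢ = suc i , bᵢ

  anyF-intro : ∀ {n} (b : Fin n → Bool) i → b i ≡ true → anyF b ≡ true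
  anyF-intro b zero    bᵢ rewrite bᵢ = refl
  anyF-intro b (suc i) bᵢ with b zero
  ... | true  = refl
  ... | false = anyF-intro (λ i → b (suc i)) i bᵢ

  anyF-none : ∀ {n} (b : Fin n → Bool) → anyF b ≡ false → ∀ i → b i ≡ false
  anyF-none b any≡false i with b i in bᵢ
  ... | false = refl
  ... | true  = trans (sym (anyF-intro b i bᵢ)) any≡false

  anyF-cong : ∀ {n} {b c : Fin n → Bool} → (∀ i → b i ≡ c i) → anyF b ≡ anyF c
  anyF-cong {zero}  b≗c = refl
  anyF-cong {suc n} b≗c = cong₂ _∨_ (b≗c zero) (anyF-cong (λ i → b≗c (suc i)))

  least-witness : ∀ {n} (b : Fin n → Bool) i → b i ≡ true →
    ∃ λ j → b j ≡ true × (∀ k → toℕ k < toℕ j → b k ≡ false)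
  least-witness b zero bᵢ = zero , bᵢ , λ k ()
  least-witness b (suc i) bᵢ with b zero in b₀
  ... | true  = zero , b₀ , λ k ()
  ... | false with least-witness (λ k → b (suc k)) i bᵢ
  ...   | j , bⱼ , below = suc j , bⱼ , λ { zero _ → b₀ ; (suc k) (s≤s k<j) → below k k<j }

  ∨-true : ∀ a b → a ∨ b ≡ true → a ≡ true ⊎ b ≡ true
  ∨-true true  b _ = inj₁ refl
  ∨-true false b b≡true = inj₂ b≡true

  ∧-true : ∀ a b → a ∧ b ≡ true → a ≡ true × b ≡ true
  ∧-true true true _ = refl , refl

  <ᵇ-true : ∀ {m n} → m < n → (m <ᵇ n) ≡ true
  <ᵇ-true m<n = Equivalence.to T-≡ (<⇒<ᵇ m<n)

  <ᵇ-sound : ∀ {m n} → (m <ᵇ n) ≡ true → m < n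
  <ᵇ-sound {m} {n} m<ᵇn = <ᵇ⇒< m n (Equivalence.from T-≡ m<ᵇn)

  -- Kleene iteration S₀, step S₀, step (step S₀), … of an inflationary,
  -- extensional operator on subsets of Fin n stabilises after n steps:
  -- each non-stable step adds an element, and there are only n of them.
  module Saturation {n : ℕ} (step : (Fin n → Bool) → Fin n → Bool)
    (step-cong : ∀ {S T} → (∀ k → S k ≡ T k) → ∀ k → step S k ≡ step T k)
    (step-inflationary : ∀ S k → S k ≡ true → step S k ≡ true)
    (S₀ : Fin n → Bool) where

    iterate : ℕ → Fin n → Bool
    iterate zero    = S₀
    iterate (suc s) = step (iterate s)

    Stable : ℕ → Set
    Stable s = ∀ k → iterate (suc s) k ≡ iterate s k

    stable-suc : ∀ {s} → Stable s → Stable (suc s)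
    stable-suc st = step-cong st

    stable-≤ : ∀ {s t} → Stable s → s ≤ t → Stable t
    stable-≤ {s} {t} st s≤t with m≤n⇒∃[o]m+o≡n s≤t
    ... | d , refl = go d
      where
        go : ∀ d → Stable (s + d)
        go zero    rewrite +-identityʳ s = st
        go (suc d) rewrite +-suc s d = stable-suc {s + d} (go d)

    progress : ∀ s → (∃ λ t → t < s × Stable t) ⊎ s ≤ count (iterate s)
    progress zero = inj₂ z≤n
    progress (suc s) with progress s
    ... | inj₁ (t , t<s , st) = inj₁ (t , m≤n⇒m≤1+n t<s , st)
    ... | inj₂ s≤count with anyF (λ k → not (iterate s k) ∧ iterate (suc s) k) in new
    ...   | true with anyF-witness _ new
    ...     | k , k-new = inj₂ (≤-trans (s≤s s≤count)
                             (count-strict _ _ (step-inflationary (iterate s)) k (new-absent k-new) (new-present k-new)))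
      where
        new-absent : ∀ {a b} → not a ∧ b ≡ true → a ≡ false
        new-absent {false} _ = refl
        new-present : ∀ {a b} → not a ∧ b ≡ true → b ≡ true
        new-present {false} {true} _ = refl
    progress (suc s) | inj₂ _ | false = inj₁ (s , n<1+n s , stable)
      where
        stable : Stable s
        stable k with iterate s k in kₛ | anyF-none _ new k
        ... | true  | _ = step-inflationary (iterate s) k kₛ
        ... | false | absent = absent

    saturated : Stable n
    saturated with progress (suc n)
    ... | inj₁ (t , t<1+n , st) = stable-≤ st (≤-pred t<1+n)
    ... | inj₂ 1+n≤count = ⊥-elim (<⇒≱ 1+n≤count (count≤n (iterate (suc n))))

  module Connectivity {m1 n1 m2 n2 : ℕ} (P : Partition m1 n1 m2 n2) where

    extend : (Fin m1 → Bool) → Fin m1 → Bool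
    extend S k = S k ∨ anyF (λ l → S l ∧ adj P l k)

    extend-cong : ∀ {S T} → (∀ k → S k ≡ T k) → ∀ k → extend S k ≡ extend T k
    extend-cong S≗T k = cong₂ _∨_ (S≗T k) (anyF-cong (λ l → cong (_∧ adj P l k) (S≗T l)))

    extend-inflationary : ∀ S k → S k ≡ true → extend S k ≡ true
    extend-inflationary S k Sk rewrite Sk = refl

    reach-saturated : ∀ i k → reachIn P (suc m1) i k ≡ reach P i k
    reach-saturated i k = begin
      reachIn P (suc m1) i k ≡⟨ as-iterate (suc m1) k ⟩
      iterate (suc m1) k     ≡⟨ saturated k ⟩
      iterate m1 k           ≡⟨ sym (as-iterate m1 k) ⟩
      reachIn P m1 i k       ∎
      where
        open ≡-Reasoning
        open Saturation extend extend-cong extend-inflationary (reachIn P 0 i)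
        as-iterate : ∀ s k → reachIn P s i k ≡ iterate s k
        as-iterate zero    k = refl
        as-iterate (suc s) k = extend-cong (as-iterate s) k

    reach-closed : ∀ {i k j} → reach P i k ≡ true → adj P k j ≡ true → reach P i j ≡ true
    reach-closed {i} {k} {j} ik kj = begin
      reach P i j            ≡⟨ sym (reach-saturated i j) ⟩
      reachIn P (suc m1) i j ≡⟨ cong (reach P i j ∨_) (anyF-intro (λ l → reach P i l ∧ adj P l j) k (cong₂ _∧_ ik kj)) ⟩
      reach P i j ∨ true     ≡⟨ ∨-zeroʳ _ ⟩
      true                   ∎
      where open ≡-Reasoning

    reachIn-refl : ∀ s i → reachIn P s i i ≡ true
    reachIn-refl zero    i = trans (isYes≗does (i ≟ i)) (dec-true (i ≟ i) refl)
    reachIn-refl (suc s) i rewrite reachIn-refl s i = refl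

    reach-refl : ∀ i → reach P i i ≡ true
    reach-refl = reachIn-refl m1

    reachIn-zero : ∀ {j k} → reachIn P 0 j k ≡ true → j ≡ k
    reachIn-zero {j} {k} jk with j ≟ k
    ... | yes j≡k = j≡k

    reach-walk : ∀ s {i j k} → reach P i j ≡ true → reachIn P s j k ≡ true → reach P i k ≡ true
    reach-walk zero ij jk rewrite reachIn-zero jk = ij
    reach-walk (suc s) {i} {j} {k} ij jk with ∨-true (reachIn P s j k) _ jk
    ... | inj₁ jk′ = reach-walk s ij jk′
    ... | inj₂ step with anyF-witness _ step
    ...   | l , jl∧lk = reach-closed (reach-walk s ij (proj₁ split)) (proj₂ split)
      where split = ∧-true (reachIn P s j l) (adj P l k) jl∧lk

    reach-trans : ∀ {i j k} → reach P i j ≡ true → reach P j k ≡ true → reach P i k ≡ true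
    reach-trans = reach-walk m1

    adj-sym : ∀ i j → adj P i j ≡ adj P j i
    adj-sym i j = anyF-cong (λ Q → ∧-comm (incA P Q i) (incA P Q j))

    reachIn-sym : ∀ s {i j} → reachIn P s i j ≡ true → reach P j i ≡ true
    reachIn-sym zero {i} ij rewrite reachIn-zero ij = reach-refl _
    reachIn-sym (suc s) {i} {j} ij with ∨-true (reachIn P s i j) _ ij
    ... | inj₁ ij′ = reachIn-sym s ij′
    ... | inj₂ step with anyF-witness _ step
    ...   | l , il∧lj = reach-trans (reach-closed (reach-refl j) (trans (adj-sym j l) (proj₂ split)))
                                    (reachIn-sym s (proj₁ split))
      where split = ∧-true (reachIn P s i l) (adj P l j) il∧lj

    reach-sym : ∀ {i j} → reach P i j ≡ true → reach P j i ≡ true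
    reach-sym = reachIn-sym m1

  module Components {m1 n1 m2 n2 : ℕ} (P : Partition m1 n1 m2 n2) where
    open Connectivity P

    rep-minimal : ∀ {i} → isRep P i ≡ true → ∀ l → toℕ l < toℕ i → reach P i l ≡ false
    rep-minimal {i} rep l l<i with anyF (λ l → (toℕ l <ᵇ toℕ i) ∧ reach P i l) in earlier
    rep-minimal {i} () l l<i | true
    ... | false with anyF-none _ earlier l
    ...   | not-earlier rewrite <ᵇ-true l<i = not-earlier

    minimal-rep : ∀ {i} → (∀ l → toℕ l < toℕ i → reach P i l ≡ false) → isRep P i ≡ true
    minimal-rep {i} minimal with anyF (λ l → (toℕ l <ᵇ toℕ i) ∧ reach P i l) in earlier
    ... | false = refl
    ... | true with anyF-witness _ earlier
    ...   | l , l<i∧il with ∧-true _ _ l<i∧il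
    ...     | l<i , il with trans (sym il) (minimal l (<ᵇ-sound l<i))
    ...       | ()

    rep-exists : ∀ j → ∃ λ i → isRep P i ≡ true × reach P i j ≡ true
    rep-exists j with least-witness (reach P j) j (reach-refl j)
    ... | i , ji , below = i , minimal-rep minimal , reach-sym ji
      where
        minimal : ∀ l → toℕ l < toℕ i → reach P i l ≡ false
        minimal l l<i with reach P i l in il
        ... | false = refl
        ... | true with trans (sym (reach-trans ji il)) (below l l<i)
        ...   | ()

    rep-unique : ∀ {i i′ j} → isRep P i ≡ true → isRep P i′ ≡ true →
      reach P i j ≡ true → reach P i′ j ≡ true → i ≡ i′
    rep-unique {i} {i′} rep rep′ ij i′j with <-cmp i i′
    ... | tri≈ _ i≡i′ _ = i≡i′
    ... | tri< i<i′ _ _ with trans (sym (reach-trans i′j (reach-sym ij))) (rep-minimal rep′ i i<i′)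
    ...   | ()
    rep-unique {i} {i′} rep rep′ ij i′j | tri> _ _ i′<i
      with trans (sym (reach-trans ij (reach-sym i′j))) (rep-minimal rep i′ i′<i)
    ... | ()

    -- Every edge lies in exactly one represented component, so the
    -- components together have m1 edges.
    edge-count : sumℕ (λ i → if isRep P i then count (compEdge P i) else 0) ≡ m1
    edge-count = begin
      sumℕ (λ i → if isRep P i then count (compEdge P i) else 0)
        ≡⟨ sumℕ-cong (λ i → if-sumℕ (isRep P i) (λ j → if reach P i j then 1 else 0)) ⟩
      sumℕ (λ i → sumℕ (λ j → inComponent i j))
        ≡⟨ sumℕ-comm inComponent ⟩
      sumℕ (λ j → sumℕ (λ i → inComponent i j))
        ≡⟨ sumℕ-cong one-component ⟩
      sumℕ {m1} (λ _ → 1)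
        ≡⟨ sumℕ-ones m1 ⟩
      m1 ∎
      where
        open ≡-Reasoning
        inComponent : Fin m1 → Fin m1 → ℕ
        inComponent i j = if isRep P i then (if reach P i j then 1 else 0) else 0
        one-component : ∀ j → sumℕ (λ i → inComponent i j) ≡ 1
        one-component j with rep-exists j
        ... | i₀ , rep₀ , i₀j = trans (sumℕ-single _ i₀ others) (at-rep)
          where
            at-rep : inComponent i₀ j ≡ 1
            at-rep rewrite rep₀ | i₀j = refl
            others : ∀ i → ¬ i ≡ i₀ → inComponent i j ≡ 0
            others i i≢i₀ with isRep P i in rep | reach P i j in ij
            ... | false | _     = refl
            ... | true  | false = refl
            ... | true  | true  = ⊥-elim (i≢i₀ (rep-unique rep rep₀ ij i₀j))

    attached : Fin (p P) → Bool
    attached Q = anyF (incA P Q)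

    componentWeight : Fin m1 → ℕ
    componentWeight i = sumℕ (λ Q → if compVertex P i Q then weight P Q else 0)

    -- Every attached vertex belongs to a represented component, so the
    -- total weight is at most the component weights plus the weight of the
    -- unattached vertices.
    weight-split : sumℕ (weight P) ≤
      sumℕ (λ i → if isRep P i then componentWeight i else 0) +
      sumℕ (λ Q → if attached Q then 0 else weight P Q)
    weight-split = begin
      sumℕ (weight P)
        ≤⟨ sumℕ-mono vertex-covered ⟩
      sumℕ (λ Q → sumℕ (λ i → inComponent i Q) + unattached Q)
        ≡⟨ sumℕ-+ (λ Q → sumℕ (λ i → inComponent i Q)) unattached ⟩
      sumℕ (λ Q → sumℕ (λ i → inComponent i Q)) + sumℕ unattached
        ≡⟨ cong (_+ sumℕ unattached) (sym (sumℕ-comm inComponent)) ⟩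
      sumℕ (λ i → sumℕ (inComponent i)) + sumℕ unattached
        ≡⟨ cong (_+ sumℕ unattached) (sym (sumℕ-cong (λ i → if-sumℕ (isRep P i) (λ Q → if compVertex P i Q then weight P Q else 0)))) ⟩
      sumℕ (λ i → if isRep P i then componentWeight i else 0) + sumℕ unattached ∎
      where
        open ≤-Reasoning
        inComponent : Fin m1 → Fin (p P) → ℕ
        inComponent i Q = if isRep P i then (if compVertex P i Q then weight P Q else 0) else 0
        unattached : Fin (p P) → ℕ
        unattached Q = if attached Q then 0 else weight P Q
        vertex-covered : ∀ Q → weight P Q ≤ sumℕ (λ i → inComponent i Q) + unattached Q
        vertex-covered Q with attached Q in att
        ... | false = m≤n+m _ _
        ... | true with anyF-witness _ att
        ...   | j , Q∈j with rep-exists j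
        ...     | i , rep , ij = ≤-trans (≤-trans (≤-reflexive (sym at-rep)) (term≤sumℕ _ i)) (m≤m+n _ _)
          where
            in-comp : compVertex P i Q ≡ true
            in-comp = anyF-intro (λ j → reach P i j ∧ incA P Q j) j (cong₂ _∧_ ij Q∈j)
            at-rep : inComponent i Q ≡ weight P Q
            at-rep rewrite rep | in-comp = refl

  extendSubset : ∀ {m} → Bool → (Fin m → Bool) → Fin (suc m) → Bool
  extendSubset b S zero    = b
  extendSubset b S (suc i) = S i

  sumSubsets : ∀ m → ((Fin m → Bool) → ℕ) → ℕ
  sumSubsets zero    h = h (λ ())
  sumSubsets (suc m) h = sumSubsets m (λ S → h (extendSubset false S)) + sumSubsets m (λ S → h (extendSubset true S))

  sumSubsets-zero : ∀ m (h : (Fin m → Bool) → ℕ) → (∀ S → h S ≡ 0) → sumSubsets m h ≡ 0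
  sumSubsets-zero zero    h h≗0 = h≗0 _
  sumSubsets-zero (suc m) h h≗0 = cong₂ _+_ (sumSubsets-zero m _ (λ S → h≗0 _)) (sumSubsets-zero m _ (λ S → h≗0 _))

  sumSubsets-+ : ∀ m (f g : (Fin m → Bool) → ℕ) → sumSubsets m (λ S → f S + g S) ≡ sumSubsets m f + sumSubsets m g
  sumSubsets-+ zero    f g = refl
  sumSubsets-+ (suc m) f g
    rewrite sumSubsets-+ m (λ S → f (extendSubset false S)) (λ S → g (extendSubset false S))
          | sumSubsets-+ m (λ S → f (extendSubset true S)) (λ S → g (extendSubset true S))
    = interchange (sumSubsets m (λ S → f (extendSubset false S))) (sumSubsets m (λ S → g (extendSubset false S)))
                  (sumSubsets m (λ S → f (extendSubset true S))) (sumSubsets m (λ S → g (extendSubset true S)))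

  sumSubsets-mono : ∀ m {f g : (Fin m → Bool) → ℕ} → (∀ S → f S ≤ g S) → sumSubsets m f ≤ sumSubsets m g
  sumSubsets-mono zero    f≤g = f≤g _
  sumSubsets-mono (suc m) f≤g = +-mono-≤ (sumSubsets-mono m (λ S → f≤g _)) (sumSubsets-mono m (λ S → f≤g _))

  sumℕ-sumSubsets : ∀ {n} m (f : Fin n → (Fin m → Bool) → ℕ) →
    sumℕ (λ Q → sumSubsets m (f Q)) ≡ sumSubsets m (λ S → sumℕ (λ Q → f Q S))
  sumℕ-sumSubsets {zero}  m f = sym (sumSubsets-zero m _ (λ _ → refl))
  sumℕ-sumSubsets {suc n} m f rewrite sumℕ-sumSubsets m (λ Q → f (suc Q)) =
    sym (sumSubsets-+ m (f zero) (λ S → sumℕ (λ Q → f (suc Q) S)))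

  sameSubset : ∀ {m} → (Fin m → Bool) → (Fin m → Bool) → Bool
  sameSubset {zero}  T S = true
  sameSubset {suc m} T S = ⌊ T zero ≟ᵇ S zero ⌋ ∧ sameSubset (λ i → T (suc i)) (λ i → S (suc i))

  sameSubset-sound : ∀ {m} (T S : Fin m → Bool) → sameSubset T S ≡ true → ∀ i → T i ≡ S i
  sameSubset-sound {suc m} T S same i with T zero ≟ᵇ S zero
  sameSubset-sound {suc m} T S same zero    | yes T₀≡S₀ = T₀≡S₀
  sameSubset-sound {suc m} T S same (suc i) | yes _ = sameSubset-sound (λ i → T (suc i)) (λ i → S (suc i)) same i

  extendSubset-cong : ∀ {m} b {S S′ : Fin m → Bool} → (∀ i → S i ≡ S′ i) → ∀ i → extendSubset b S i ≡ extendSubset b S′ i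
  extendSubset-cong b S≗S′ zero    = refl
  extendSubset-cong b S≗S′ (suc i) = S≗S′ i

  sumSubsets-pick : ∀ m (h : (Fin m → Bool) → ℕ) → (∀ S S′ → (∀ i → S i ≡ S′ i) → h S ≡ h S′) →
    ∀ T → sumSubsets m (λ S → if sameSubset T S then h S else 0) ≡ h T
  sumSubsets-pick zero h h-ext T = h-ext _ _ (λ ())
  sumSubsets-pick (suc m) h h-ext T = trans (by-head (T zero)) (h-ext _ _ head-tail)
    where
      T′ : Fin m → Bool
      T′ i = T (suc i)
      head-tail : ∀ i → extendSubset (T zero) T′ i ≡ T i
      head-tail zero    = refl
      head-tail (suc i) = refl
      pick-tail : ∀ b → sumSubsets m (λ S → if sameSubset T′ S then h (extendSubset b S) else 0) ≡ h (extendSubset b T′)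
      pick-tail b = sumSubsets-pick m _ (λ S S′ S≗S′ → h-ext _ _ (extendSubset-cong b S≗S′)) T′
      -- only the subsets with the same head as T contribute
      by-head : ∀ b → sumSubsets (suc m) (λ S → if sameSubset (extendSubset b T′) S then h S else 0) ≡ h (extendSubset b T′)
      by-head false = trans (cong₂ _+_ (pick-tail false) (sumSubsets-zero m _ (λ _ → refl))) (+-identityʳ _)
      by-head true  = cong₂ _+_ (sumSubsets-zero m _ (λ _ → refl)) (pick-tail true)

  sumSubsets-ones : ∀ m → sumSubsets m (λ _ → 1) ≡ 2 ^ m
  sumSubsets-ones zero    = refl
  sumSubsets-ones (suc m) rewrite sumSubsets-ones m = cong (2 ^ m +_) (sym (+-identityʳ (2 ^ m)))

  sumSubsets-count : ∀ k → sumSubsets (suc k) count ≡ suc k * 2 ^ k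
  sumSubsets-count zero    = refl
  sumSubsets-count (suc k) = begin
    sumSubsets (suc k) count + sumSubsets (suc k) (λ S → 1 + count S)
      ≡⟨ cong (sumSubsets (suc k) count +_) (sumSubsets-+ (suc k) (λ _ → 1) count) ⟩
    sumSubsets (suc k) count + (sumSubsets (suc k) (λ _ → 1) + sumSubsets (suc k) count)
      ≡⟨ cong₂ (λ a b → a + (b + a)) (sumSubsets-count k) (sumSubsets-ones (suc k)) ⟩
    suc k * 2 ^ k + (2 * 2 ^ k + suc k * 2 ^ k)
      ≡⟨ solve 2 (λ k x → (con 1 :+ k) :* x :+ (con 2 :* x :+ (con 1 :+ k) :* x) := (con 2 :+ k) :* (con 2 :* x)) refl k (2 ^ k) ⟩
    suc (suc k) * 2 ^ suc k ∎
    where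
      open ≡-Reasoning
      open +-*-Solver

  sumSubsets-count-bound : ∀ m → sumSubsets m count ≤ m * 2 ^ (m ∸ 1)
  sumSubsets-count-bound zero    = z≤n
  sumSubsets-count-bound (suc k) = ≤-reflexive (sumSubsets-count k)

  -- In an asymmetric τ(P), two vertices meeting exactly the same edges
  -- coincide: otherwise swapping them would be a nontrivial automorphism.
  twins-equal : ∀ {m1 n1 m2 n2} (P : Partition m1 n1 m2 n2) → Asymmetric P →
    ∀ {Q Q′} → (∀ Y → inc P Q Y ≡ inc P Q′ Y) → Q ≡ Q′
  twins-equal {m1} {m2 = m2} P asym {Q} {Q′} twins =
    trans (sym (proj₁ (asym (Perm.transpose Q Q′) (↔-id (Edge m1 m2)) swap-automorphism) Q)) swap-Q
    where
      swap-Q : PC.transpose Q Q′ Q ≡ Q′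
      swap-Q with Q ≟ Q
      ... | yes _   = refl
      ... | no Q≢Q = ⊥-elim (Q≢Q refl)
      swap-automorphism : IsAut P (Perm.transpose Q Q′) (↔-id (Edge m1 m2))
      swap-automorphism R Y with R ≟ Q
      ... | yes refl = twins Y
      ... | no _ with R ≟ Q′
      ...   | yes refl = sym (twins Y)
      ...   | no _     = refl

  -- The unattached vertices of τ'(P) have pairwise distinct labels L(Q),
  -- hence their total weight is at most Σ_{S ⊆ {1..m2}} |S| = m2·2^(m2-1).
  module UnattachedVertices {m1 n1 m2 n2 : ℕ} (P : Partition m1 n1 m2 n2) (asym : Asymmetric P) where
    open Components P

    label : Fin (p P) → Fin m2 → Bool
    label Q = incB P Q

    -- An unattached vertex meets no A_i, so its incidences are determined by its label.
    labels-injective : ∀ {Q Q′} → attached Q ≡ false → attached Q′ ≡ false →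
      (∀ j → label Q j ≡ label Q′ j) → Q ≡ Q′
    labels-injective {Q} {Q′} Q-free Q′-free same-label = twins-equal P asym twins
      where
        twins : ∀ Y → inc P Q Y ≡ inc P Q′ Y
        twins (inj₁ i) = trans (anyF-none _ Q-free i) (sym (anyF-none _ Q′-free i))
        twins (inj₂ j) = same-label j

    hasLabel : (Fin m2 → Bool) → Fin (p P) → Bool
    hasLabel S Q = not (attached Q) ∧ sameSubset (label Q) S

    unattached-weight-bound : sumℕ (λ Q → if attached Q then 0 else weight P Q) ≤ m2 * 2 ^ (m2 ∸ 1)
    unattached-weight-bound = begin
      sumℕ (λ Q → if attached Q then 0 else weight P Q)
        ≡⟨ sumℕ-cong by-label ⟩
      sumℕ (λ Q → sumSubsets m2 (λ S → if hasLabel S Q then count S else 0))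
        ≡⟨ sumℕ-sumSubsets m2 (λ Q S → if hasLabel S Q then count S else 0) ⟩
      sumSubsets m2 (λ S → sumℕ (λ Q → if hasLabel S Q then count S else 0))
        ≤⟨ sumSubsets-mono m2 (λ S → sumℕ-atMostOne (hasLabel S) (count S) (label-owner S)) ⟩
      sumSubsets m2 count
        ≤⟨ sumSubsets-count-bound m2 ⟩
      m2 * 2 ^ (m2 ∸ 1) ∎
      where
        open ≤-Reasoning
        count-ext : ∀ S S′ → (∀ j → S j ≡ S′ j) → count S ≡ count S′
        count-ext S S′ S≗S′ = sumℕ-cong (λ j → cong (λ b → if b then 1 else 0) (S≗S′ j))
        by-label : ∀ Q → (if attached Q then 0 else weight P Q) ≡
                         sumSubsets m2 (λ S → if hasLabel S Q then count S else 0)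
        by-label Q with attached Q
        ... | true  = sym (sumSubsets-zero m2 _ (λ _ → refl))
        ... | false = sym (sumSubsets-pick m2 count count-ext (label Q))
        label-owner : ∀ S Q Q′ → hasLabel S Q ≡ true → hasLabel S Q′ ≡ true → Q ≡ Q′
        label-owner S Q Q′ QS Q′S with attached Q in Q-att | attached Q′ in Q′-att
        ... | false | false = labels-injective Q-att Q′-att
              (λ j → trans (sameSubset-sound _ _ QS j) (sym (sameSubset-sound _ _ Q′S j)))

module RationalArithmetic where

  open import Defs
  open import Data.Bool using (Bool; true; false; if_then_else_)
  open import Data.Nat as ℕ using (ℕ; zero; suc)
  open import Data.Fin using (Fin; zero; suc)
  open import Data.Integer as ℤ using (+≤+)
  open import Data.Rational using (mkℚ; _/_; 0ℚ; _+_; _-_; -_; _*_; _≤_; *≤*)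
  open import Data.Rational.Properties using (normalize-coprime; +-monoˡ-≤; +-identityˡ)
  open import Data.Rational.Solver using (module +-*-Solver)
  open import Data.Nat.Coprimality using (1-coprimeTo) renaming (sym to coprime-sym)
  import Data.Integer.Properties as ℤ
  open import Relation.Binary.PropositionalEquality

  ℕ→ℚ-canonical : ∀ n → ℕ→ℚ n ≡ mkℚ (ℤ.+ n) 0 (coprime-sym (1-coprimeTo n))
  ℕ→ℚ-canonical n = normalize-coprime (coprime-sym (1-coprimeTo n))

  ℕ→ℚ-+ : ∀ x y → ℕ→ℚ (x ℕ.+ y) ≡ ℕ→ℚ x + ℕ→ℚ y
  ℕ→ℚ-+ x y rewrite ℕ→ℚ-canonical x | ℕ→ℚ-canonical y =
    cong (λ z → z / 1) (sym (cong₂ ℤ._+_ (ℤ.*-identityʳ (ℤ.+ x)) (ℤ.*-identityʳ (ℤ.+ y))))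

  ℕ→ℚ-mono : ∀ {x y} → x ℕ.≤ y → ℕ→ℚ x ≤ ℕ→ℚ y
  ℕ→ℚ-mono {x} {y} x≤y rewrite ℕ→ℚ-canonical x | ℕ→ℚ-canonical y =
    *≤* (subst₂ ℤ._≤_ (sym (ℤ.*-identityʳ (ℤ.+ x))) (sym (ℤ.*-identityʳ (ℤ.+ y))) (+≤+ x≤y))

  sumℚ-selected : ∀ {n} (b : Fin n → Bool) (a e : Fin n → ℕ) X →
    sumℚ (λ i → if b i then ℕ→ℚ (a i) - X * ℕ→ℚ (e i) else 0ℚ) ≡
    ℕ→ℚ (sumℕ (λ i → if b i then a i else 0)) - X * ℕ→ℚ (sumℕ (λ i → if b i then e i else 0))
  sumℚ-selected {zero} b a e X = solve 1 (λ X → con 0ℚ := con 0ℚ :- X :* con 0ℚ) refl X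
    where open +-*-Solver
  sumℚ-selected {suc n} b a e X with b zero
  ... | false = trans (+-identityˡ _) (sumℚ-selected (λ i → b (suc i)) (λ i → a (suc i)) (λ i → e (suc i)) X)
  ... | true  = begin
    (ℕ→ℚ (a zero) - X * ℕ→ℚ (e zero)) + sumℚ (λ i → if b (suc i) then ℕ→ℚ (a (suc i)) - X * ℕ→ℚ (e (suc i)) else 0ℚ)
      ≡⟨ cong ((ℕ→ℚ (a zero) - X * ℕ→ℚ (e zero)) +_) (sumℚ-selected (λ i → b (suc i)) (λ i → a (suc i)) (λ i → e (suc i)) X) ⟩
    (ℕ→ℚ (a zero) - X * ℕ→ℚ (e zero)) + (ℕ→ℚ A - X * ℕ→ℚ E)
      ≡⟨ solve 5 (λ a₀ e₀ A E X → (a₀ :- X :* e₀) :+ (A :- X :* E) := (a₀ :+ A) :- X :* (e₀ :+ E)) refl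
                 (ℕ→ℚ (a zero)) (ℕ→ℚ (e zero)) (ℕ→ℚ A) (ℕ→ℚ E) X ⟩
    (ℕ→ℚ (a zero) + ℕ→ℚ A) - X * (ℕ→ℚ (e zero) + ℕ→ℚ E)
      ≡⟨ sym (cong₂ (λ u v → u - X * v) (ℕ→ℚ-+ (a zero) A) (ℕ→ℚ-+ (e zero) E)) ⟩
    ℕ→ℚ (a zero ℕ.+ A) - X * ℕ→ℚ (e zero ℕ.+ E) ∎
    where
      open ≡-Reasoning
      open +-*-Solver
      A = sumℕ (λ i → if b (suc i) then a (suc i) else 0)
      E = sumℕ (λ i → if b (suc i) then e (suc i) else 0)

  shift-bound : ∀ {W} A B Y → W ℕ.≤ A ℕ.+ B → ℕ→ℚ W - Y ≤ (ℕ→ℚ A - Y) + ℕ→ℚ B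
  shift-bound {W} A B Y W≤A+B = subst (ℕ→ℚ W - Y ≤_) regroup (+-monoˡ-≤ (- Y) (ℕ→ℚ-mono W≤A+B))
    where
      open +-*-Solver
      regroup : ℕ→ℚ (A ℕ.+ B) - Y ≡ (ℕ→ℚ A - Y) + ℕ→ℚ B
      regroup = trans (cong (_- Y) (ℕ→ℚ-+ A B)) (solve 3 (λ a b y → (a :+ b) :- y := (a :- y) :+ b) refl (ℕ→ℚ A) (ℕ→ℚ B) Y)

open import Defs
open import Data.Nat using (ℕ; NonZero; _≤_; _^_; _∸_; _*_)
open import Data.Rational using (_+_) renaming (_≤_ to _≤ℚ_)
open import Data.Bool using (if_then_else_)
import Data.Nat as ℕ
import Data.Nat.Properties as ℕ
import Data.Rational as ℚ
import Data.Rational.Properties as ℚ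
open import Relation.Binary.PropositionalEquality using (_≡_; cong; sym; trans)
open Combinatorics using (module Components; module UnattachedVertices)
open RationalArithmetic using (sumℚ-selected; shift-bound)

lemma4p8 : (m1 m2 n1 n2 : ℕ) → .{{_ : NonZero m2}} → 1 ≤ m1 → 1 ≤ n2 → 2 ≤ n1 →
    (P : Partition m1 n1 m2 n2) → Regular P → Asymmetric P →
    valueTotal P ≤ℚ (sumComp P + ℕ→ℚ (m2 * 2 ^ (m2 ∸ 1)))
lemma4p8 m1 m2 n1 n2 _ _ _ P _ asym = begin
  valueTotal P                          ≤⟨ shift-bound A B (X ℚ.* ℕ→ℚ m1) total-weight ⟩
  (ℕ→ℚ A ℚ.- X ℚ.* ℕ→ℚ m1) + ℕ→ℚ B     ≡⟨ cong (_+ ℕ→ℚ B) (sym components-value) ⟩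
  sumComp P + ℕ→ℚ B                     ∎
  where
    open ℚ.≤-Reasoning
    open Components P
    X : ℚ.ℚ
    X = r n1 m2 ℚ.* ℕ→ℚ m2
    A : ℕ
    A = sumℕ (λ i → if isRep P i then componentWeight i else 0)
    B : ℕ
    B = m2 * 2 ^ (m2 ∸ 1)
    total-weight : sumℕ (weight P) ≤ A ℕ.+ B
    total-weight = ℕ.≤-trans weight-split (ℕ.+-monoʳ-≤ A (UnattachedVertices.unattached-weight-bound P asym))
    -- Σ_G v(G) = Σ_G w(G) - X·m1, as the components share out all m1 edges
    components-value : sumComp P ≡ ℕ→ℚ A ℚ.- X ℚ.* ℕ→ℚ m1
    components-value = trans (sumℚ-selected (isRep P) componentWeight (λ i → count (compEdge P i)) X)
                             (cong (λ e → ℕ→ℚ A ℚ.- X ℚ.* ℕ→ℚ e) edge-count)
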